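{- Let $n\ge 1$ and let $A$ and $B$ be the models over the empty signature with domains $\{1,\ldots,n\}$ and $\{1,\ldots,n+1\}$ respectively. Then for every Inclusion Logic sentence $\phi$ with $\mathrm{rank}(\phi)\le n$, if $A\models\phi$ then $B\models\phi$.
   Context: Teams are sets of assignments into the domain of a model; $X(\bar t)=\{\bar t\langle s\rangle:s\in X\}$. Inclusion Logic formulas are first-order formulas in negation normal form (here over the empty signature, so atoms are equalities) plus inclusion atoms $\bar t_1\subseteq\bar t_2$, with lax team semantics: literals hold in $X$ iff they hold under every $s\in X$; $M\models_X\bar t_1\subseteq\bar t_2$ iff $X(\bar t_1)\subseteq X(\bar t_2)$; $M\models_X\phi\vee\psi$ iff $X=Y\cup Z$ with $M\models_Y\phi$, $M\models_Z\psi$; $\wedge$ is conjunction; $M\models_X\exists v\phi$ iff $M\models_{X[H/v]}\phi$ for some $H:X\to\mathcal P(\mathrm{dom}(M))\setminus\{\emptyset\}$, where $X[H/v]=\{s[m/v]:s\in X,m\in H(s)\}$; $M\models_X\forall v\phi$ iff $M\models_{X[M/v]}\phi$, where $X[M/v]=\{s[m/v]:s\in X,m\in\mathrm{dom}(M)\}$. A sentence $\phi$ is true in $M$ ($M\models\phi$) iff $M\models_{\{\emptyset\}}\phi$, where $\{\emptyset\}$ is the team containing only the empty assignment. Rank: literals and inclusion atoms have rank $0$; $\mathrm{rank}(\psi\wedge\theta)=\max(\mathrm{rank}\psi,\mathrm{rank}\theta)$; $\mathrm{rank}(\psi\vee\theta)=\max(\mathrm{rank}\psi,\mathrm{rank}\theta)+1$;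 $\mathrm{rank}(\exists v\psi)=\mathrm{rank}(\forall v\psi)=\mathrm{rank}(\psi)+1$. -}

module Defs where

open import Level using (Level; 0ℓ) renaming (suc to lsuc)
open import Data.Nat using (ℕ; zero; suc; _⊔_)
open import Data.Fin using (Fin)
open import Data.Vec using (Vec; []; _∷_; lookup; map)
open import Data.Product using (Σ; ∃; _×_; _,_)
open import Data.Sum using (_⊎_)
open import Relation.Binary.PropositionalEquality using (_≡_)
open import Relation.Nullary using (¬_)

-- Inclusion Logic formulas over the empty signature, in negation normal form,
-- with variables in de Bruijn style: a  Formula k  has at most k variables in scope
-- (variable i refers to the i-th most recently bound variable).
-- Terms over the empty signature are just variables.
data Formula : ℕ → Set where
  eq   : ∀ {k} → Fin k → Fin k → Formula k
  neq  : ∀ {k} → Fin k → Fin k → Formula k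
  incl : ∀ {k m} → Vec (Fin k) m → Vec (Fin k) m → Formula k
  _∧'_ : ∀ {k} → Formula k → Formula k → Formula k
  _∨'_ : ∀ {k} → Formula k → Formula k → Formula k
  ex   : ∀ {k} → Formula (suc k) → Formula k
  all  : ∀ {k} → Formula (suc k) → Formula k

Sentence : Set
Sentence = Formula 0

rank : ∀ {k} → Formula k → ℕ
rank (eq _ _)   = 0
rank (neq _ _)  = 0
rank (incl _ _) = 0
rank (φ ∧' ψ)   = rank φ ⊔ rank ψ
rank (φ ∨' ψ)   = suc (rank φ ⊔ rank ψ)
rank (ex φ)     = suc (rank φ)
rank (all φ)    = suc (rank φ)

Assignment : Set → ℕ → Set
Assignment D k = Vec D k

Team : Set → ℕ → Set₁
Team D k = Assignment D k → Set

-- X[H/v] for H : X → P(D) (nonemptiness is required separately in the semantics)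
supplement : ∀ {D k} → Team D k → (Assignment D k → D → Set) → Team D (suc k)
supplement X H (m ∷ s) = X s × H s m

duplicate : ∀ {D k} → Team D k → Team D (suc k)
duplicate X (m ∷ s) = X s

-- Lax team semantics in the model with domain D (empty signature).
_⊨[_]_ : (D : Set) → ∀ {k} → Team D k → Formula k → Set₁
D ⊨[ X ] eq i j   = ∀ s → X s → Level.Lift (lsuc 0ℓ) (lookup s i ≡ lookup s j)
D ⊨[ X ] neq i j  = ∀ s → X s → Level.Lift (lsuc 0ℓ) (¬ (lookup s i ≡ lookup s j))
D ⊨[ X ] incl t u = ∀ s → X s → Level.Lift (lsuc 0ℓ)
                      (∃ λ s' → X s' × map (lookup s) t ≡ map (lookup s') u)
D ⊨[ X ] (φ ∧' ψ) = (D ⊨[ X ] φ) × (D ⊨[ X ] ψ)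
D ⊨[ X ] (φ ∨' ψ) = Σ (Team D _) λ Y → Σ (Team D _) λ Z →
                      ((∀ s → X s → Y s ⊎ Z s) × (∀ s → Y s → X s) × (∀ s → Z s → X s))
                      × (D ⊨[ Y ] φ) × (D ⊨[ Z ] ψ)
D ⊨[ X ] ex φ     = Σ (Assignment D _ → D → Set) λ H →
                      (∀ s → X s → ∃ λ m → H s m) × (D ⊨[ supplement X H ] φ)
D ⊨[ X ] all φ    = D ⊨[ duplicate X ] φ

emptyTeam : (D : Set) → Team D 0
emptyTeam D s = s ≡ []

_⊨_ : Set → Sentence → Set₁
D ⊨ φ = D ⊨[ emptyTeam D ] φ

module Submission where

-- Transport a team X over Fin n to the team of all images of its assignments
-- under injections Fin n ↣ Fin m.  Identity atoms and inclusion atoms are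
-- invariant under injections, and splittings and choice functions for X induce
-- ones for the image.  The only place the size of Fin n matters is ∀: an
-- assignment of k < n variables leaves some a ∈ Fin n unused, so an injection
-- can be redefined at a to hit any value b of the larger model.  The rank bound
-- guarantees k < n at every universal quantifier.

open import Defs
open import Level using (lift; lower)
open import Data.Nat using (ℕ; suc; _≤_; _<_; _+_)
open import Data.Nat.Properties using (≤-trans; +-monoʳ-≤; m≤m⊔n; m≤n⊔m; m≤n⇒m≤1+n; +-suc; m+n≤o⇒m≤o)
open import Data.Fin using (Fin; _≟_)
import Data.Fin as Fin
open import Data.Fin.Properties using (pigeonhole; any?; ¬∀⟶∃¬; suc-injective; <⇒≢)
open import Data.Vec using (Vec; []; _∷_; lookup; map)
open import Data.Vec.Properties using (lookup-map; map-∘; map-cong)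
open import Data.Vec.Functional using (updateAt)
open import Data.Vec.Functional.Properties using (updateAt-updates; updateAt-minimal)
open import Data.Product using (∃; ∃-syntax; _×_; _,_; proj₁; proj₂)
open import Data.Sum using (_⊎_)
import Data.Sum as Sum
open import Function using (_∘_; const)
open import Function.Bundles using (_↣_; mk↣)
open import Function.Definitions using (Injective)
open import Relation.Binary.PropositionalEquality
open import Relation.Nullary using (¬_; yes; no; contradiction)

open Function.Bundles.Injection using (to; injective)
open ≡-Reasoning

vector-not-surjective : ∀ {n k} → k < n → (s : Vec (Fin n) k) → ¬ (∀ a → ∃[ i ] lookup s i ≡ a)
vector-not-surjective k<n s surj with i , j , i<j , si≡sj ← pigeonhole k<n (proj₁ ∘ surj)
  = <⇒≢ i<j (trans (sym (proj₂ (surj i))) (trans (cong (lookup s) si≡sj) (proj₂ (surj j))))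

missing-element : ∀ {n k} → k < n → (s : Vec (Fin n) k) → ∃[ a ] ∀ i → lookup s i ≢ a
missing-element {n} k<n s
  with a , a∉s ← ¬∀⟶∃¬ n _ (λ a → any? λ i → lookup s i ≟ a) (vector-not-surjective k<n s)
  = a , λ i e → a∉s (i , e)

updateAt-injective : ∀ {n} {B : Set} {f : Fin n → B} a b → Injective _≡_ _≡_ f → (∀ x → f x ≢ b) →
  Injective _≡_ _≡_ (updateAt f a (const b))
updateAt-injective {f = f} a b f-inj b∉f {x} {y} gx≡gy with x ≟ a | y ≟ a
... | yes x≡a  | yes y≡a = trans x≡a (sym y≡a)
... | yes refl | no y≢a  =
  contradiction (trans (sym (updateAt-minimal y a f y≢a)) (trans (sym gx≡gy) (updateAt-updates a f))) (b∉f y)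
... | no x≢a   | yes refl =
  contradiction (trans (sym (updateAt-minimal x a f x≢a)) (trans gx≡gy (updateAt-updates a f))) (b∉f x)
... | no x≢a   | no y≢a  =
  f-inj (trans (sym (updateAt-minimal x a f x≢a)) (trans gx≡gy (updateAt-minimal y a f y≢a)))

map-updateAt-missing : ∀ {n k} {B : Set} (f : Fin n → B) a b (s : Vec (Fin n) k) →
  (∀ i → lookup s i ≢ a) → map (updateAt f a (const b)) s ≡ map f s
map-updateAt-missing f a b []      a∉s = refl
map-updateAt-missing f a b (x ∷ s) a∉s =
  cong₂ _∷_ (updateAt-minimal x a f (a∉s Fin.zero)) (map-updateAt-missing f a b s (a∉s ∘ Fin.suc))

module _ {n m : ℕ} where

  extend-injection : ∀ {k} → k < n → (f : Fin n ↣ Fin m) (s : Vec (Fin n) k) (b : Fin m) →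
    ∃[ g ] ∃[ a ] to g a ≡ b × map (to g) s ≡ map (to f) s
  extend-injection k<n f s b with any? (λ a → to f a ≟ b)
  ... | yes (a , fa≡b) = f , a , fa≡b , refl
  ... | no b∉f with a , a∉s ← missing-element k<n s =
    mk↣ (updateAt-injective a b (injective f) (λ x fx≡b → b∉f (x , fx≡b))) , a ,
    updateAt-updates a (to f) , map-updateAt-missing (to f) a b s a∉s

lookup-map-lookup : ∀ {A B : Set} {k l} (f : A → B) (s : Vec A k) (u : Vec (Fin k) l) →
  map (lookup (map f s)) u ≡ map f (map (lookup s) u)
lookup-map-lookup f s u = trans (map-cong (λ i → lookup-map i f s) u) (map-∘ f (lookup s) u)

weaken-bound : ∀ k {a b n} → a ≤ b → k + b ≤ n → k + a ≤ n
weaken-bound k a≤b = ≤-trans (+-monoʳ-≤ k a≤b)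

bind-bound : ∀ k r {n} → k + suc r ≤ n → suc k + r ≤ n
bind-bound k r {n} = subst (_≤ n) (+-suc k r)

_⊆ᵀ_ : ∀ {D k} → Team D k → Team D k → Set
X ⊆ᵀ Y = ∀ s → X s → Y s

_≐ᵀ_ : ∀ {D k} → Team D k → Team D k → Set
X ≐ᵀ Y = X ⊆ᵀ Y × Y ⊆ᵀ X

supplement-mono : ∀ {D k} {X Y : Team D k} {H} → X ⊆ᵀ Y → supplement X H ⊆ᵀ supplement Y H
supplement-mono X⊆Y (m ∷ s) (xs , hm) = X⊆Y s xs , hm

duplicate-mono : ∀ {D k} {X Y : Team D k} → X ⊆ᵀ Y → duplicate X ⊆ᵀ duplicate Y
duplicate-mono X⊆Y (m ∷ s) = X⊆Y s

⊨-resp-≐ᵀ : ∀ {D k} (φ : Formula k) {X Y : Team D k} → X ≐ᵀ Y → D ⊨[ X ] φ → D ⊨[ Y ] φ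
⊨-resp-≐ᵀ (eq i j)   (_ , Y⊆X) h s ys = h s (Y⊆X s ys)
⊨-resp-≐ᵀ (neq i j)  (_ , Y⊆X) h s ys = h s (Y⊆X s ys)
⊨-resp-≐ᵀ (incl u v) (X⊆Y , Y⊆X) h s ys with s' , xs' , e ← lower (h s (Y⊆X s ys)) =
  lift (s' , X⊆Y s' xs' , e)
⊨-resp-≐ᵀ (φ ∧' ψ) X≐Y (hφ , hψ) = ⊨-resp-≐ᵀ φ X≐Y hφ , ⊨-resp-≐ᵀ ψ X≐Y hψ
⊨-resp-≐ᵀ (φ ∨' ψ) (X⊆Y , Y⊆X) (V , W , (cover , V⊆X , W⊆X) , hφ , hψ) =
  V , W , ((λ s → cover s ∘ Y⊆X s) , (λ s → X⊆Y s ∘ V⊆X s) , (λ s → X⊆Y s ∘ W⊆X s)) , hφ , hψ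
⊨-resp-≐ᵀ (ex φ) (X⊆Y , Y⊆X) (H , nonempty , h) =
  H , (λ s → nonempty s ∘ Y⊆X s) , ⊨-resp-≐ᵀ φ (supplement-mono X⊆Y , supplement-mono Y⊆X) h
⊨-resp-≐ᵀ (all φ) (X⊆Y , Y⊆X) h = ⊨-resp-≐ᵀ φ (duplicate-mono X⊆Y , duplicate-mono Y⊆X) h

module _ {n m : ℕ} where

  injectiveImage : ∀ {k} → Team (Fin n) k → Team (Fin m) k
  injectiveImage X t = ∃ λ (f : Fin n ↣ Fin m) → ∃[ s ] X s × t ≡ map (to f) s

  injectiveImage-mono : ∀ {k} {X Y : Team (Fin n) k} → X ⊆ᵀ Y → injectiveImage X ⊆ᵀ injectiveImage Y
  injectiveImage-mono X⊆Y t (f , s , xs , t≡fs) = f , s , X⊆Y s xs , t≡fs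

  injectiveImage-emptyTeam : Fin n ↣ Fin m → injectiveImage (emptyTeam (Fin n)) ≐ᵀ emptyTeam (Fin m)
  injectiveImage-emptyTeam f = (λ { [] _ → refl }) , (λ { [] refl → f , [] , refl , refl })

  injectiveImage-supplement : ∀ {k} (X : Team (Fin n) k) (H : Assignment (Fin n) k → Fin n → Set) →
    injectiveImage (supplement X H) ≐ᵀ supplement (injectiveImage X) (λ t b → injectiveImage (supplement X H) (b ∷ t))
  injectiveImage-supplement X H =
    (λ { (b ∷ t) image@(f , a ∷ s , (xs , ha) , refl) → (f , s , xs , refl) , image }) ,
    (λ { (b ∷ t) (_ , image) → image })

  injectiveImage-duplicate : ∀ {k} → k < n → (X : Team (Fin n) k) →
    injectiveImage (duplicate X) ≐ᵀ duplicate (injectiveImage X)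
  injectiveImage-duplicate k<n X =
    (λ { (b ∷ t) (f , a ∷ s , xs , refl) → f , s , xs , refl }) ,
    (λ { (b ∷ t) (f , s , xs , refl) → lift-value b f s xs })
    where
    lift-value : ∀ b f s → X s → injectiveImage (duplicate X) (b ∷ map (to f) s)
    lift-value b f s xs with g , a , ga≡b , gs≡fs ← extend-injection k<n f s b =
      g , a ∷ s , xs , cong₂ _∷_ (sym ga≡b) (sym gs≡fs)

  ⊨-injectiveImage : ∀ {k} (φ : Formula k) (X : Team (Fin n) k) → k + rank φ ≤ n →
    Fin n ⊨[ X ] φ → Fin m ⊨[ injectiveImage X ] φ
  ⊨-injectiveImage (eq i j) X _ h _ (f , s , xs , refl) = lift (begin
    lookup (map (to f) s) i  ≡⟨ lookup-map i (to f) s ⟩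
    to f (lookup s i)        ≡⟨ cong (to f) (lower (h s xs)) ⟩
    to f (lookup s j)        ≡⟨ lookup-map j (to f) s ⟨
    lookup (map (to f) s) j  ∎)
  ⊨-injectiveImage (neq i j) X _ h _ (f , s , xs , refl) = lift λ fsi≡fsj →
    lower (h s xs) (injective f (trans (sym (lookup-map i (to f) s)) (trans fsi≡fsj (lookup-map j (to f) s))))
  ⊨-injectiveImage (incl u v) X _ h _ (f , s , xs , refl) with s' , xs' , su≡s'v ← lower (h s xs) =
    lift (map (to f) s' , (f , s' , xs' , refl) , (begin
      map (lookup (map (to f) s)) u   ≡⟨ lookup-map-lookup (to f) s u ⟩
      map (to f) (map (lookup s) u)   ≡⟨ cong (map (to f)) su≡s'v ⟩
      map (to f) (map (lookup s') v)  ≡⟨ lookup-map-lookup (to f) s' v ⟨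
      map (lookup (map (to f) s')) v  ∎))
  ⊨-injectiveImage {k} (φ ∧' ψ) X r (hφ , hψ) =
    ⊨-injectiveImage φ X (weaken-bound k (m≤m⊔n _ _) r) hφ ,
    ⊨-injectiveImage ψ X (weaken-bound k (m≤n⊔m _ _) r) hψ
  ⊨-injectiveImage {k} (φ ∨' ψ) X r (Y , Z , (cover , Y⊆X , Z⊆X) , hφ , hψ) =
    injectiveImage Y , injectiveImage Z ,
    (cover′ , injectiveImage-mono Y⊆X , injectiveImage-mono Z⊆X) ,
    ⊨-injectiveImage φ Y (weaken-bound k (m≤n⇒m≤1+n (m≤m⊔n _ _)) r) hφ ,
    ⊨-injectiveImage ψ Z (weaken-bound k (m≤n⇒m≤1+n (m≤n⊔m _ _)) r) hψ
    where
    cover′ : ∀ t → injectiveImage X t → injectiveImage Y t ⊎ injectiveImage Z t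
    cover′ t (f , s , xs , t≡fs) = Sum.map (λ ys → f , s , ys , t≡fs) (λ zs → f , s , zs , t≡fs) (cover s xs)
  ⊨-injectiveImage {k} (ex φ) X r (H , nonempty , h) =
    (λ t b → injectiveImage (supplement X H) (b ∷ t)) , nonempty′ ,
    ⊨-resp-≐ᵀ φ (injectiveImage-supplement X H) (⊨-injectiveImage φ (supplement X H) (bind-bound k _ r) h)
    where
    nonempty′ : ∀ t → injectiveImage X t → ∃[ b ] injectiveImage (supplement X H) (b ∷ t)
    nonempty′ _ (f , s , xs , refl) with a , ha ← nonempty s xs = to f a , f , a ∷ s , (xs , ha) , refl
  ⊨-injectiveImage {k} (all φ) X r h =
    ⊨-resp-≐ᵀ φ (injectiveImage-duplicate (m+n≤o⇒m≤o (suc k) r′) X) (⊨-injectiveImage φ (duplicate X) r′ h)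
    where
    r′ : suc k + rank φ ≤ n
    r′ = bind-bound k (rank φ) r

proposition30 : (n : ℕ) → 1 ≤ n → (φ : Sentence) → rank φ ≤ n →
    Fin n ⊨ φ → Fin (suc n) ⊨ φ
proposition30 n _ φ r A⊨φ =
  ⊨-resp-≐ᵀ φ (injectiveImage-emptyTeam (mk↣ suc-injective)) (⊨-injectiveImage φ (emptyTeam (Fin n)) r A⊨φ)
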